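{- Let $C\ge 2$ be even, $D\ge 1$, and let $\mathcal{S}=(S_i)_{i=1}^{2^{D-1}}$ be a partition of $C\cdot 2^{D-1}$ distinct labels into sets of size $C$. Then $|V(G_{\mathcal{S}})| \leq 2^{C\cdot 2^{D+1}}$.
   Context: Interleaving: for two sets $S_1,S_2$ of $C$ labels each, $I(S_1,S_2)=\{S_1'\cup S_2' : S_j'\subseteq S_j, |S_j'|=C/2\}$. For a tuple $\mathcal{S}=(S_i)_{i=1}^{2^{D-1}}$ of pairwise disjoint $C$-element label sets ($D\ge 2$), $I(\mathcal{S})=\prod_{i=1}^{2^{D-2}} I(S_{2i-1},S_{2i})$. Construction of the labeled graph $G_{\mathcal{S}}$ by recursion on $D$: If $D=1$, $G_{\mathcal{S}}$ is a single edge $(r,v)$ carrying all labels of $S_1$, with $r$ the root of every label. If $D>1$: (1) for each $i=1,\dots,2^{D-2}$ introduce new vertices $r_{2i-1},r_{2i},v_i$ and edges $e_{2i-1}=(r_{2i-1},v_i)$, $e_{2i}=(r_{2i},v_i)$; $e_j$ carries all labels of $S_j$ and $r_j$ is the root of every label of $S_j$; (2) add the disjoint union of $G_{\mathcal{S}'}$ for all $\mathcal{S}'\in I(\mathcal{S})$, edges keeping their labels; (3) in each copy, every root vertex $r$ is incident to a single edge with label set $\chi(r)$; if $\chi(r)\in I(S_{2i-1},S_{2i})$, identify $r$ with $v_i$. -}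

module Defs where

open import Data.Bool using (Bool; true; false; _∧_; _∨_; if_then_else_; not)
open import Data.Nat using (ℕ; zero; suc; _+_; _*_; ⌊_/2⌋; _≡ᵇ_)
open import Data.List using (List; []; _∷_; _++_; length; map; concatMap; upTo; zip; deduplicateᵇ)
open import Data.Bool.ListAction using (any; all)
open import Data.Product using (_×_; _,_; proj₁; proj₂)
open import Data.Maybe using (Maybe; just; nothing)

-- Labels are natural numbers; a label set is a (duplicate-free) list of labels.
Label : Set
Label = ℕ

LabelSet : Set
LabelSet = List Label

memᵇ : Label → LabelSet → Bool
memᵇ x ys = any (λ y → x ≡ᵇ y) ys

setEqᵇ : LabelSet → LabelSet → Bool
setEqᵇ xs ys = all (λ x → memᵇ x ys) xs ∧ all (λ y → memᵇ y xs) ys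

listEqᵇ : LabelSet → LabelSet → Bool
listEqᵇ [] [] = true
listEqᵇ (x ∷ xs) (y ∷ ys) = (x ≡ᵇ y) ∧ listEqᵇ xs ys
listEqᵇ _ _ = false

tupleEqᵇ : List LabelSet → List LabelSet → Bool
tupleEqᵇ [] [] = true
tupleEqᵇ (x ∷ xs) (y ∷ ys) = listEqᵇ x y ∧ tupleEqᵇ xs ys
tupleEqᵇ _ _ = false

choose : {A : Set} → ℕ → List A → List (List A)
choose zero xs = [] ∷ []
choose (suc k) [] = []
choose (suc k) (x ∷ xs) = map (x ∷_) (choose k xs) ++ choose (suc k) xs

interleave₂ : ℕ → LabelSet → LabelSet → List LabelSet
interleave₂ C S₁ S₂ =
  concatMap (λ a → map (a ++_) (choose ⌊ C /2⌋ S₂)) (choose ⌊ C /2⌋ S₁)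

pairUp : {A : Set} → List A → List (A × A)
pairUp (x ∷ y ∷ xs) = (x , y) ∷ pairUp xs
pairUp _ = []

cartesian : {A : Set} → List (List A) → List (List A)
cartesian [] = [] ∷ []
cartesian (xs ∷ xss) = concatMap (λ x → map (x ∷_) (cartesian xss)) xs

interleave : ℕ → List LabelSet → List (List LabelSet)
interleave C S = cartesian (map (λ p → interleave₂ C (proj₁ p) (proj₂ p)) (pairUp S))

-- Vertices are symbolic names:
--   rt j        : the new vertex r_j   (0-indexed)
--   vt i        : the new vertex v_i   (0-indexed)
--   cp S' x     : vertex x of the copy G_{S'}, S' ∈ I(𝒮)
-- Identification of vertices is performed by renaming a copy's root
-- vertex to the corresponding vt i, and then removing duplicates.

data Vtx : Set where
  rt : ℕ → Vtx
  vt : ℕ → Vtx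
  cp : List LabelSet → Vtx → Vtx

vtxEqᵇ : Vtx → Vtx → Bool
vtxEqᵇ (rt m) (rt n) = m ≡ᵇ n
vtxEqᵇ (vt m) (vt n) = m ≡ᵇ n
vtxEqᵇ (cp s x) (cp t y) = tupleEqᵇ s t ∧ vtxEqᵇ x y
vtxEqᵇ _ _ = false

record LGraph : Set where
  field
    vertices   : List Vtx                      -- duplicate-free vertex list
    edges      : List (Vtx × Vtx × LabelSet)   -- edge (u , w , labels carried)
    labelRoots : List (Label × Vtx)
open LGraph public

∣V∣ : LGraph → ℕ
∣V∣ G = length (vertices G)

rootVertices : LGraph → List Vtx
rootVertices G = deduplicateᵇ vtxEqᵇ (map proj₂ (labelRoots G))

isRootᵇ : LGraph → Vtx → Bool
isRootᵇ G x = any (vtxEqᵇ x) (rootVertices G)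

-- χ(r): label set of the (single) edge incident to r (first one found)
χ : LGraph → Vtx → LabelSet
χ G r = go (edges G)
  where
  go : List (Vtx × Vtx × LabelSet) → LabelSet
  go [] = []
  go ((u , w , L) ∷ es) = if vtxEqᵇ u r ∨ vtxEqᵇ w r then L else go es

-- index i (0-based) with L ∈ I(S_{2i+1}, S_{2i+2}), if any
findPair : ℕ → List LabelSet → LabelSet → Maybe ℕ
findPair C S L = go 0 (pairUp S)
  where
  go : ℕ → List (LabelSet × LabelSet) → Maybe ℕ
  go i [] = nothing
  go i ((a , b) ∷ ps) =
    if any (setEqᵇ L) (interleave₂ C a b) then just i else go (suc i) ps

indexed : {A : Set} → List A → List (ℕ × A)
indexed xs = zip (upTo (length xs)) xs

-- The construction G_𝒮 (parameters: C, D, 𝒮).  Defined for D ≥ 1;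
-- the clause D = 0 is a junk value (same as D = 1) and never used.

mutual
  G : ℕ → ℕ → List LabelSet → LGraph
  G C zero S = base S
  G C (suc zero) S = base S
  G C (suc (suc d)) S = step C S (G C (suc d))

  base : List LabelSet → LGraph
  base S = record
    { vertices   = rt 0 ∷ vt 0 ∷ []
    ; edges      = (rt 0 , vt 0 , S₁) ∷ []
    ; labelRoots = map (λ l → l , rt 0) S₁
    }
    where
    S₁ : LabelSet
    S₁ = first S
      where
      first : List LabelSet → LabelSet
      first [] = []
      first (s ∷ _) = s

  step : ℕ → List LabelSet → (List LabelSet → LGraph) → LGraph
  step C S rec = record
    { vertices   = deduplicateᵇ vtxEqᵇ
                     (newV ++ concatMap (λ S' → map (σ S') (vertices (rec S'))) (interleave C S))
    ; edges      = newE ++ concatMap (λ S' → map (σE S') (edges (rec S'))) (interleave C S)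
    ; labelRoots = concatMap (λ p → map (λ l → l , rt (proj₁ p)) (proj₂ p)) (indexed S)
    }
    where
    newV : List Vtx
    newV = map rt (upTo (length S)) ++ map vt (upTo (length (pairUp S)))

    newE : List (Vtx × Vtx × LabelSet)
    newE = concatMap
      (λ p → (rt (2 * proj₁ p) , vt (proj₁ p) , proj₁ (proj₂ p))
           ∷ (rt (suc (2 * proj₁ p)) , vt (proj₁ p) , proj₂ (proj₂ p)) ∷ [])
      (indexed (pairUp S))

    σ : List LabelSet → Vtx → Vtx
    σ S' x with isRootᵇ (rec S') x
    ... | false = cp S' x
    ... | true with findPair C S (χ (rec S') x)
    ...   | just i  = vt i
    ...   | nothing = cp S' x

    σE : List LabelSet → Vtx × Vtx × LabelSet → Vtx × Vtx × LabelSet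
    σE S' (u , w , L) = σ S' u , σ S' w , L

-- Induction on the depth: if 𝒮 has at most 2^d label sets of size ≤ C, then
-- G_𝒮 at depth d + 1 has at most 2^(4C·2^d) vertices.  For the step, let
-- 𝒮 have at most 2a label sets, a = 2^d.  The construction adds |𝒮| root
-- vertices r_j, ⌊|𝒮|/2⌋ ≤ a vertices v_i, and one copy of G_{𝒮'} for every
-- 𝒮' ∈ I(𝒮); identifying vertices only shrinks the vertex list.  Each factor
-- I(S, S') has at most 2^C · 2^C elements (a pair of subsets), so
-- |I(𝒮)| ≤ 2^(2C·a), and each 𝒮' ∈ I(𝒮) is a tuple of at most a label sets
-- of size ≤ C, to which the induction hypothesis applies.  Altogether
--     |V(G_𝒮)| ≤ 3a + 2^(2Ca) · 2^(4Ca) ≤ 2^(8Ca) = 2^(4C·2a).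
module Submission where

open import Defs
open import Data.Nat using (ℕ; _≤_; _*_; _^_; _∸_; _+_)
open import Data.Nat.Divisibility using (_∣_)
open import Data.List using (List; length)
open import Data.List.Relation.Unary.All using (All)
open import Data.List.Relation.Unary.AllPairs using (AllPairs)
open import Data.List.Relation.Unary.Unique.Propositional using (Unique)
open import Data.List.Relation.Binary.Disjoint.Propositional using (Disjoint)
open import Data.Product using (_×_)
open import Relation.Binary.PropositionalEquality using (_≡_)

open import Data.Nat using (zero; suc; z≤n; s≤s; ⌊_/2⌋; _<_)
open import Data.Nat.Properties
open import Data.Nat.Tactic.RingSolver using (solve-∀)
open import Data.List using ([]; _∷_; _++_; map; concatMap; upTo)
open import Data.List.Properties using (length-++; length-map; length-upTo; length-deduplicate)
open import Data.List.Relation.Unary.All using ([]; _∷_)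
import Data.List.Relation.Unary.All as All
import Data.List.Relation.Unary.All.Properties as All
open import Data.Product using (_,_; proj₁; proj₂)
open import Function using (_∘_)
open import Relation.Binary.PropositionalEquality using (refl; sym; trans; cong; cong₂)

private
  variable
    A B E : Set

concatMap⁺ : {P : B → Set} (f : A → List B) {xs : List A} →
             All (λ x → All P (f x)) xs → All P (concatMap f xs)
concatMap⁺ f = All.concat⁺ ∘ All.map⁺

length-concatMap-map-≤ : (g : A → B → E) (ys : A → List B) (m : ℕ) (xs : List A) →
                         All (λ x → length (ys x) ≤ m) xs →
                         length (concatMap (λ x → map (g x) (ys x)) xs) ≤ length xs * m
length-concatMap-map-≤ g ys m [] [] = z≤n
length-concatMap-map-≤ g ys m (x ∷ xs) (p ∷ ps) = begin
  length (map (g x) (ys x) ++ rest)          ≡⟨ length-++ (map (g x) (ys x)) ⟩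
  length (map (g x) (ys x)) + length rest    ≡⟨ cong (_+ length rest) (length-map (g x) (ys x)) ⟩
  length (ys x) + length rest                ≤⟨ +-mono-≤ p (length-concatMap-map-≤ g ys m xs ps) ⟩
  m + length xs * m                          ∎
  where
  open ≤-Reasoning
  rest = concatMap (λ x → map (g x) (ys x)) xs

length-choose-≤ : (k : ℕ) (xs : List A) → length (choose k xs) ≤ 2 ^ length xs
length-choose-≤ zero    xs       = m^n>0 2 (length xs)
length-choose-≤ (suc k) []       = z≤n
length-choose-≤ (suc k) (x ∷ xs) = begin
  length (map (x ∷_) (choose k xs) ++ choose (suc k) xs)
    ≡⟨ length-++ (map (x ∷_) (choose k xs)) ⟩
  length (map (x ∷_) (choose k xs)) + length (choose (suc k) xs)
    ≡⟨ cong (_+ length (choose (suc k) xs)) (length-map (x ∷_) (choose k xs)) ⟩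
  length (choose k xs) + length (choose (suc k) xs)
    ≤⟨ +-mono-≤ (length-choose-≤ k xs) (length-choose-≤ (suc k) xs) ⟩
  2 ^ length xs + 2 ^ length xs
    ≡⟨ cong (2 ^ length xs +_) (sym (+-identityʳ (2 ^ length xs))) ⟩
  2 ^ suc (length xs) ∎
  where open ≤-Reasoning

choose-length : (k : ℕ) (xs : List A) → All (λ ys → length ys ≡ k) (choose k xs)
choose-length zero    xs       = refl ∷ []
choose-length (suc k) []       = []
choose-length (suc k) (x ∷ xs) =
  All.++⁺ (All.map⁺ (All.map (cong suc) (choose-length k xs))) (choose-length (suc k) xs)

length-cartesian-≤ : (m : ℕ) (xss : List (List A)) →
                     All (λ xs → length xs ≤ m) xss → length (cartesian xss) ≤ m ^ length xss
length-cartesian-≤ m []         []       = ≤-refl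
length-cartesian-≤ m (xs ∷ xss) (p ∷ ps) = begin
  length (cartesian (xs ∷ xss))  ≤⟨ length-concatMap-map-≤ (λ x → x ∷_) (λ _ → cartesian xss) _ xs
                                      (All.tabulate (λ _ → length-cartesian-≤ m xss ps)) ⟩
  length xs * m ^ length xss     ≤⟨ *-monoˡ-≤ (m ^ length xss) p ⟩
  m * m ^ length xss             ∎
  where open ≤-Reasoning

cartesian-shape : {P : A → Set} (xss : List (List A)) → All (All P) xss →
                  All (λ t → length t ≡ length xss × All P t) (cartesian xss)
cartesian-shape []         []       = (refl , []) ∷ []
cartesian-shape (xs ∷ xss) (p ∷ ps) = concatMap⁺ (λ x → map (x ∷_) (cartesian xss))
  (All.map (λ px → All.map⁺ (All.map (λ (len , qs) → cong suc len , px ∷ qs) (cartesian-shape xss ps))) p)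

length-pairUp : (xs : List A) → 2 * length (pairUp xs) ≤ length xs
length-pairUp []           = z≤n
length-pairUp (x ∷ [])     = z≤n
length-pairUp (x ∷ y ∷ xs) = ≤-trans (≤-reflexive (*-suc 2 (length (pairUp xs)))) (s≤s (s≤s (length-pairUp xs)))

pairUp⁺ : {P : A → Set} (xs : List A) → All P xs → All (λ p → P (proj₁ p) × P (proj₂ p)) (pairUp xs)
pairUp⁺ []           _              = []
pairUp⁺ (x ∷ [])     _              = []
pairUp⁺ (x ∷ y ∷ xs) (px ∷ py ∷ ps) = (px , py) ∷ pairUp⁺ xs ps

half+half≤ : ∀ C → ⌊ C /2⌋ + ⌊ C /2⌋ ≤ C
half+half≤ C = ≤-trans (+-monoʳ-≤ ⌊ C /2⌋ (⌊n/2⌋≤⌈n/2⌉ C)) (≤-reflexive (⌊n/2⌋+⌈n/2⌉≡n C))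

length-interleave₂-≤ : ∀ C (s₁ s₂ : LabelSet) → length s₁ ≤ C → length s₂ ≤ C →
                       length (interleave₂ C s₁ s₂) ≤ 2 ^ (C + C)
length-interleave₂-≤ C s₁ s₂ h₁ h₂ = begin
  length (interleave₂ C s₁ s₂)
    ≤⟨ length-concatMap-map-≤ _++_ (λ _ → choose ⌊ C /2⌋ s₂) (2 ^ C) (choose ⌊ C /2⌋ s₁)
         (All.tabulate (λ _ → ≤-trans (length-choose-≤ ⌊ C /2⌋ s₂) (^-monoʳ-≤ 2 h₂))) ⟩
  length (choose ⌊ C /2⌋ s₁) * 2 ^ C
    ≤⟨ *-monoˡ-≤ (2 ^ C) (≤-trans (length-choose-≤ ⌊ C /2⌋ s₁) (^-monoʳ-≤ 2 h₁)) ⟩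
  2 ^ C * 2 ^ C
    ≡⟨ sym (^-distribˡ-+-* 2 C C) ⟩
  2 ^ (C + C) ∎
  where open ≤-Reasoning

-- Every member of I(S₁,S₂) is a union of two C/2-sets, so has size ≤ C.
interleave₂-sizes : ∀ C (s₁ s₂ : LabelSet) → All (λ L → length L ≤ C) (interleave₂ C s₁ s₂)
interleave₂-sizes C s₁ s₂ =
  concatMap⁺ (λ x → map (x ++_) (choose ⌊ C /2⌋ s₂))
    (All.map (λ {x} x-half → All.map⁺ (All.map (λ {y} y-half → union-size x y x-half y-half)
                                               (choose-length ⌊ C /2⌋ s₂)))
             (choose-length ⌊ C /2⌋ s₁))
  where
  union-size : (x y : LabelSet) → length x ≡ ⌊ C /2⌋ → length y ≡ ⌊ C /2⌋ → length (x ++ y) ≤ C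
  union-size x y ex ey = ≤-trans (≤-reflexive (trans (length-++ x) (cong₂ _+_ ex ey))) (half+half≤ C)

length-interleave-≤ : ∀ C (S : List LabelSet) → All (λ s → length s ≤ C) S →
                      length (interleave C S) ≤ 2 ^ ((C + C) * length (pairUp S))
length-interleave-≤ C S sizes = begin
  length (cartesian (map factor (pairUp S)))
    ≤⟨ length-cartesian-≤ (2 ^ (C + C)) (map factor (pairUp S))
         (All.map⁺ (All.map (λ (h₁ , h₂) → length-interleave₂-≤ C _ _ h₁ h₂) (pairUp⁺ S sizes))) ⟩
  (2 ^ (C + C)) ^ length (map factor (pairUp S))
    ≡⟨ cong ((2 ^ (C + C)) ^_) (length-map factor (pairUp S)) ⟩
  (2 ^ (C + C)) ^ length (pairUp S)
    ≡⟨ ^-*-assoc 2 (C + C) (length (pairUp S)) ⟩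
  2 ^ ((C + C) * length (pairUp S)) ∎
  where
  open ≤-Reasoning
  factor : LabelSet × LabelSet → List LabelSet
  factor (s₁ , s₂) = interleave₂ C s₁ s₂

interleave-shape : ∀ C (S : List LabelSet) →
                   All (λ S' → length S' ≡ length (pairUp S) × All (λ L → length L ≤ C) S') (interleave C S)
interleave-shape C S =
  All.map (λ (len , sizes) → trans len (length-map factor (pairUp S)) , sizes)
    (cartesian-shape (map factor (pairUp S))
      (All.map⁺ (All.tabulate (λ {p} _ → interleave₂-sizes C (proj₁ p) (proj₂ p)))))
  where
  factor : LabelSet × LabelSet → List LabelSet
  factor (s₁ , s₂) = interleave₂ C s₁ s₂

-- One recursive step: new vertices r_j and v_i, plus the (renamed) vertices
-- of the copies; removing duplicates can only decrease the count.
step-size : ∀ C S (rec : List LabelSet → LGraph) (m : ℕ) →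
            All (λ S' → ∣V∣ (rec S') ≤ m) (interleave C S) →
            ∣V∣ (step C S rec) ≤ (length S + length (pairUp S)) + length (interleave C S) * m
step-size C S rec m copies =
  ≤-trans (length-deduplicate _ (new ++ _))
    (≤-trans (≤-reflexive (length-++ new))
      (+-mono-≤ (≤-reflexive new-length)
                (length-concatMap-map-≤ _ (vertices ∘ rec) m (interleave C S) copies)))
  where
  new : List Vtx
  new = map rt (upTo (length S)) ++ map vt (upTo (length (pairUp S)))
  new-length : length new ≡ length S + length (pairUp S)
  new-length = trans (length-++ (map rt (upTo (length S))))
    (cong₂ _+_ (trans (length-map rt (upTo (length S))) (length-upTo (length S)))
               (trans (length-map vt (upTo (length (pairUp S)))) (length-upTo (length (pairUp S)))))

n<2^n : ∀ n → n < 2 ^ n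
n<2^n zero    = s≤s z≤n
n<2^n (suc n) = begin-strict
  suc n                  <⟨ s≤s (n<2^n n) ⟩
  suc (2 ^ n)            ≡⟨ +-comm 1 (2 ^ n) ⟩
  2 ^ n + 1              ≤⟨ +-monoʳ-≤ (2 ^ n) (≤-trans (m^n>0 2 n) (m≤m+n (2 ^ n) 0)) ⟩
  2 ^ n + (2 ^ n + 0)    ∎
  where open ≤-Reasoning

-- The closing inequality of the induction step (a = 2^d, C ≥ 1):
-- 3a + 2^(2Ca)·2^(4Ca) ≤ 2·2^(6Ca) ≤ 2^(8Ca).
closing-bound : ∀ C a → 1 ≤ C → 1 ≤ a →
                (2 * a + a) + 2 ^ ((C + C) * a) * 2 ^ (C * (4 * a)) ≤ 2 ^ (C * (4 * (2 * a)))
closing-bound C a 1≤C 1≤a = begin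
  (2 * a + a) + 2 ^ ((C + C) * a) * 2 ^ (C * (4 * a))
    ≡⟨ cong ((2 * a + a) +_) (sym (^-distribˡ-+-* 2 ((C + C) * a) (C * (4 * a)))) ⟩
  (2 * a + a) + 2 ^ ((C + C) * a + C * (4 * a))
    ≡⟨ cong (λ k → (2 * a + a) + 2 ^ k) (six C a) ⟩
  (2 * a + a) + 2 ^ (6 * e)
    ≤⟨ +-monoˡ-≤ (2 ^ (6 * e)) 3a≤2^6e ⟩
  2 ^ (6 * e) + 2 ^ (6 * e)
    ≡⟨ cong (2 ^ (6 * e) +_) (sym (+-identityʳ (2 ^ (6 * e)))) ⟩
  2 ^ suc (6 * e)
    ≤⟨ ^-monoʳ-≤ 2 (≤-trans (≤-reflexive (+-comm 1 (6 * e))) (+-monoʳ-≤ (6 * e) 1≤2e)) ⟩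
  2 ^ (6 * e + 2 * e)
    ≡⟨ cong (2 ^_) (eight C a) ⟩
  2 ^ (C * (4 * (2 * a))) ∎
  where
  open ≤-Reasoning
  e = C * a
  six : ∀ C a → (C + C) * a + C * (4 * a) ≡ 6 * (C * a)
  six = solve-∀
  eight : ∀ C a → 6 * (C * a) + 2 * (C * a) ≡ C * (4 * (2 * a))
  eight = solve-∀
  three : ∀ a → 2 * a + a ≡ 3 * a
  three = solve-∀
  a≤e : a ≤ e
  a≤e = ≤-trans (≤-reflexive (sym (*-identityˡ a))) (*-monoˡ-≤ a 1≤C)
  1≤2e : 1 ≤ 2 * e
  1≤2e = ≤-trans (≤-trans 1≤a a≤e) (m≤m+n e (e + 0))
  3a≤2^6e : 2 * a + a ≤ 2 ^ (6 * e)
  3a≤2^6e = ≤-trans (≤-reflexive (three a))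
              (≤-trans (*-mono-≤ {3} {6} (s≤s (s≤s (s≤s z≤n))) a≤e) (<⇒≤ (n<2^n (6 * e))))

vertex-bound : ∀ C → 1 ≤ C → ∀ d (S : List LabelSet) → length S ≤ 2 ^ d →
               All (λ s → length s ≤ C) S → ∣V∣ (G C (suc d) S) ≤ 2 ^ (C * (4 * 2 ^ d))
vertex-bound C 1≤C zero    S _     _     = ^-monoʳ-≤ 2 {1} (≤-trans 1≤C (m≤m*n C 4))
vertex-bound C 1≤C (suc d) S |S|≤2a sizes = begin
  ∣V∣ (step C S (G C (suc d)))
    ≤⟨ step-size C S (G C (suc d)) M copies-bounded ⟩
  (length S + length (pairUp S)) + length (interleave C S) * M
    ≤⟨ +-mono-≤ (+-mono-≤ |S|≤2a pairs≤a) (*-monoˡ-≤ M interleave≤) ⟩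
  (2 * a + a) + 2 ^ ((C + C) * a) * M
    ≤⟨ closing-bound C a 1≤C (m^n>0 2 d) ⟩
  2 ^ (C * (4 * (2 * a))) ∎
  where
  open ≤-Reasoning
  a = 2 ^ d
  M = 2 ^ (C * (4 * a))
  pairs≤a : length (pairUp S) ≤ a
  pairs≤a = *-cancelˡ-≤ 2 (≤-trans (length-pairUp S) |S|≤2a)
  interleave≤ : length (interleave C S) ≤ 2 ^ ((C + C) * a)
  interleave≤ = ≤-trans (length-interleave-≤ C S sizes) (^-monoʳ-≤ 2 (*-monoʳ-≤ (C + C) pairs≤a))
  copies-bounded : All (λ S' → ∣V∣ (G C (suc d) S') ≤ M) (interleave C S)
  copies-bounded = All.map (λ {S'} (len , sizes') → vertex-bound C 1≤C d S' (≤-trans (≤-reflexive len) pairs≤a) sizes')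
                           (interleave-shape C S)

four-times-2^ : ∀ d → 4 * 2 ^ d ≡ 2 ^ (suc d + 1)
four-times-2^ d = trans (double-double (2 ^ d)) (cong (2 ^_) (cong suc (+-comm 1 d)))
  where
  double-double : ∀ x → 4 * x ≡ 2 * (2 * x)
  double-double = solve-∀

lemma3 : (C D : ℕ) → 2 ≤ C → 2 ∣ C → 1 ≤ D →
         (S : List LabelSet) → length S ≡ 2 ^ (D ∸ 1) →
         All (λ s → length s ≡ C × Unique s) S →
         AllPairs Disjoint S →
         ∣V∣ (G C D S) ≤ 2 ^ (C * 2 ^ (D + 1))
lemma3 C zero    _   _ () _
lemma3 C (suc d) 2≤C _ _  S |S|≡ label-sets _ = begin
  ∣V∣ (G C (suc d) S)
    ≤⟨ vertex-bound C (≤-trans (s≤s z≤n) 2≤C) d S (≤-reflexive |S|≡) (All.map (≤-reflexive ∘ proj₁) label-sets) ⟩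
  2 ^ (C * (4 * 2 ^ d))
    ≡⟨ cong (λ k → 2 ^ (C * k)) (four-times-2^ d) ⟩
  2 ^ (C * 2 ^ (suc d + 1)) ∎
  where open ≤-Reasoning
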